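{- Let $\{(Q_i,M_i)\}_{i\in I}$ be a family of objects of the category $\mathcal{QM}$, and let $R=\coprod_{i\in I}Q_i$ be the coproduct of the $Q_i$ in the category of unital quantales, with coprojections $\nu_i\colon Q_i\to R$. For each $i$, regard $R$ as a right $Q_i$-module via $r\cdot a=r\,\nu_i(a)$, form the tensor product $R\otimes_{Q_i}M_i$ (a left $R$-module via $r\cdot(s\otimes x)=(rs)\otimes x$), and let $1\otimes\iota_{M_i}\colon M_i\to R\otimes_{Q_i}M_i$, $x\mapsto 1\otimes x$ (a $Q_i$-module morphism into the restriction of scalars along $\nu_i$). Let $\coprod_{i\in I}R\otimes_{Q_i}M_i$ be the coproduct of the family $\{R\otimes_{Q_i}M_i\}_{i\in I}$ in the category of left $R$-modules, with canonical $R$-module morphisms $\mu_i\colon R\otimes_{Q_i}M_i\to\coprod_{j\in I}R\otimes_{Q_j}M_j$. Then the coproduct of the family $\{(Q_i,M_i)\}_{i\in I}$ in $\mathcal{QM}$ is $$\Bigl(R,\ \coprod_{i\in I}R\otimes_{Q_i}M_i\Bigr)$$ with coprojections $(\nu_i,\ \mu_i\circ(1\otimes\iota_{M_i}))$, $i\in I$.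
   Context: A sup-lattice is a complete lattice; sup-lattice morphisms are maps preserving arbitrary joins. A (unital) quantale $\langle Q,\bigvee,\cdot,1\rangle$ is a sup-lattice with a monoid structure whose multiplication distributes over arbitrary joins on both sides; quantale homomorphisms preserve arbitrary joins, multiplication and unit. A left $Q$-module is a sup-lattice $M$ with an action $Q\times M\to M$ satisfying $(ab)x=a(bx)$, $1x=x$ and distributing over arbitrary joins in each argument; right modules are defined symmetrically. A $Q$-module morphism is a join-preserving map commuting with the action. If $h\colon Q\to R$ is a quantale homomorphism and $N$ is a left $R$-module, $N_h$ denotes the left $Q$-module with the same sup-lattice and action $a\cdot_h x=h(a)\cdot x$ (restriction of scalars). For a right $Q$-module $M_1$ and left $Q$-module $M_2$, the tensor product $M_1\otimes_Q M_2$ is the quotient of the free sup-lattice $\wp(M_1\times M_2)$ by the sup-lattice congruence generated by the pairs $(\{(\bigvee X,y)\},\{(x,y):x\in X\})$, $(\{(x,\bigvee Y)\},\{(x,y):y\in Y\})$, $(\{(xa,y)\},\{(x,ay)\})$; $x\otimes y$ is the class of $\{(x,y)\}$. The category $\mathcal{QM}$ has as objects pairs $(Q,M)$ with $Q$ a unital quantale and $M$ a left $Q$-module; a morphism $(Q,M)\to(R,N)$ is a pair $(h,f)$ with $h\colon Q\to R$ a unital quantale homomorphism and $f\colon M\to N_h$ a $Q$-module morphism; composition is componentwise. -}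

module Defs where

open import Level using (Level; _⊔_; suc; Lift; lift; lower)
open import Relation.Binary using (Rel; IsPartialOrder; IsEquivalence; IsPreorder)
open import Data.Product using (Σ; _×_; _,_; proj₁; proj₂)
open import Data.Bool using (Bool; true; false)
open import Data.Maybe using (Maybe; just; nothing)
open import Function using (_∘_; id)

record SupLattice (c ℓ ι : Level) : Set (suc (c ⊔ ℓ ⊔ ι)) where
  infix 4 _≈_ _≤_
  field
    Carrier        : Set c
    _≈_            : Rel Carrier ℓ
    _≤_            : Rel Carrier ℓ
    isPartialOrder : IsPartialOrder _≈_ _≤_
    ⋁              : {I : Set ι} → (I → Carrier) → Carrier
    ⋁-upper        : {I : Set ι} (f : I → Carrier) (i : I) → f i ≤ ⋁ f
    ⋁-least        : {I : Set ι} (f : I → Carrier) (x : Carrier) →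
                     (∀ i → f i ≤ x) → ⋁ f ≤ x
  open IsPartialOrder isPartialOrder public using (isEquivalence)
  open IsEquivalence isEquivalence public
    using () renaming (refl to ≈-refl; sym to ≈-sym; trans to ≈-trans)

record IsSupHom {a aℓ b bℓ ι : Level} (L : SupLattice a aℓ ι) (L′ : SupLattice b bℓ ι)
                (f : SupLattice.Carrier L → SupLattice.Carrier L′) : Set (a ⊔ aℓ ⊔ bℓ ⊔ suc ι) where
  private
    module L = SupLattice L
    module L′ = SupLattice L′
  field
    cong  : ∀ {x y} → x L.≈ y → f x L′.≈ f y
    ⋁-hom : {I : Set ι} (g : I → L.Carrier) → f (L.⋁ g) L′.≈ L′.⋁ (λ i → f (g i))

record Quantale (c ℓ ι : Level) : Set (suc (c ⊔ ℓ ⊔ ι)) where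
  field
    supLattice : SupLattice c ℓ ι
  open SupLattice supLattice public
  infixl 7 _∙_
  field
    _∙_         : Carrier → Carrier → Carrier
    ε           : Carrier
    ∙-cong      : ∀ {a a′ b b′} → a ≈ a′ → b ≈ b′ → a ∙ b ≈ a′ ∙ b′
    ∙-assoc     : ∀ a b c → (a ∙ b) ∙ c ≈ a ∙ (b ∙ c)
    ∙-identityˡ : ∀ a → ε ∙ a ≈ a
    ∙-identityʳ : ∀ a → a ∙ ε ≈ a
    ∙-distribˡ  : ∀ a {I : Set ι} (f : I → Carrier) → a ∙ ⋁ f ≈ ⋁ (λ i → a ∙ f i)
    ∙-distribʳ  : ∀ {I : Set ι} (f : I → Carrier) b → ⋁ f ∙ b ≈ ⋁ (λ i → f i ∙ b)

record IsQuantaleHom {q qℓ r rℓ ι : Level} (Q : Quantale q qℓ ι) (R : Quantale r rℓ ι)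
                     (h : Quantale.Carrier Q → Quantale.Carrier R) : Set (q ⊔ qℓ ⊔ rℓ ⊔ suc ι) where
  private
    module Q = Quantale Q
    module R = Quantale R
  field
    isSupHom : IsSupHom Q.supLattice R.supLattice h
    ∙-hom    : ∀ a b → h (a Q.∙ b) R.≈ h a R.∙ h b
    ε-hom    : h Q.ε R.≈ R.ε
  open IsSupHom isSupHom public

record LeftModule {q qℓ ι : Level} (Q : Quantale q qℓ ι) (c ℓ : Level)
                  : Set (q ⊔ qℓ ⊔ suc (c ⊔ ℓ ⊔ ι)) where
  private module Q = Quantale Q
  field
    supLattice : SupLattice c ℓ ι
  open SupLattice supLattice public
  infixr 7 _·_
  field
    _·_        : Q.Carrier → Carrier → Carrier
    ·-cong     : ∀ {a a′ x x′} → a Q.≈ a′ → x ≈ x′ → a · x ≈ a′ · x′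
    ·-assoc    : ∀ a b x → (a Q.∙ b) · x ≈ a · (b · x)
    ·-identity : ∀ x → Q.ε · x ≈ x
    ·-distribˡ : ∀ a {I : Set ι} (f : I → Carrier) → a · ⋁ f ≈ ⋁ (λ i → a · f i)
    ·-distribʳ : ∀ {I : Set ι} (g : I → Q.Carrier) x → Q.⋁ g · x ≈ ⋁ (λ i → g i · x)

record RightModule {q qℓ ι : Level} (Q : Quantale q qℓ ι) (c ℓ : Level)
                   : Set (q ⊔ qℓ ⊔ suc (c ⊔ ℓ ⊔ ι)) where
  private module Q = Quantale Q
  field
    supLattice : SupLattice c ℓ ι
  open SupLattice supLattice public
  infixl 7 _◃_
  field
    _◃_        : Carrier → Q.Carrier → Carrier
    ◃-cong     : ∀ {x x′ a a′} → x ≈ x′ → a Q.≈ a′ → x ◃ a ≈ x′ ◃ a′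
    ◃-assoc    : ∀ x a b → x ◃ (a Q.∙ b) ≈ (x ◃ a) ◃ b
    ◃-identity : ∀ x → x ◃ Q.ε ≈ x
    ◃-distribˡ : ∀ {I : Set ι} (f : I → Carrier) a → ⋁ f ◃ a ≈ ⋁ (λ i → f i ◃ a)
    ◃-distribʳ : ∀ x {I : Set ι} (g : I → Q.Carrier) → x ◃ Q.⋁ g ≈ ⋁ (λ i → x ◃ g i)

record IsModuleHom {q qℓ ι a aℓ b bℓ : Level} {Q : Quantale q qℓ ι}
                   (M : LeftModule Q a aℓ) (N : LeftModule Q b bℓ)
                   (f : LeftModule.Carrier M → LeftModule.Carrier N)
                   : Set (q ⊔ a ⊔ aℓ ⊔ bℓ ⊔ suc ι) where
  private
    module M = LeftModule M
    module N = LeftModule N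
  field
    isSupHom : IsSupHom M.supLattice N.supLattice f
    ·-hom    : ∀ a x → f (a M.· x) N.≈ a N.· f x
  open IsSupHom isSupHom public

restrict : {q qℓ r rℓ ι n nℓ : Level} {Q : Quantale q qℓ ι} {R : Quantale r rℓ ι}
           {h : Quantale.Carrier Q → Quantale.Carrier R} →
           IsQuantaleHom Q R h → LeftModule R n nℓ → LeftModule Q n nℓ
restrict {Q = Q} {R} {h} hh N = record
  { supLattice = N.supLattice
  ; _·_        = λ a x → h a N.· x
  ; ·-cong     = λ e e′ → N.·-cong (H.cong e) e′
  ; ·-assoc    = λ a b x → N.≈-trans (N.·-cong (H.∙-hom a b) N.≈-refl) (N.·-assoc (h a) (h b) x)
  ; ·-identity = λ x → N.≈-trans (N.·-cong H.ε-hom N.≈-refl) (N.·-identity x)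
  ; ·-distribˡ = λ a f → N.·-distribˡ (h a) f
  ; ·-distribʳ = λ g x → N.≈-trans (N.·-cong (H.⋁-hom g) N.≈-refl) (N.·-distribʳ (λ i → h (g i)) x)
  }
  where
    module N = LeftModule N
    module H = IsQuantaleHom hh

restrictRight : {q qℓ ι : Level} {Q R : Quantale q qℓ ι}
                {ν : Quantale.Carrier Q → Quantale.Carrier R} →
                IsQuantaleHom Q R ν → RightModule Q q qℓ
restrictRight {Q = Q} {R} {ν} hν = record
  { supLattice = R.supLattice
  ; _◃_        = λ r a → r R.∙ ν a
  ; ◃-cong     = λ e e′ → R.∙-cong e (H.cong e′)
  ; ◃-assoc    = λ x a b → R.≈-trans (R.∙-cong R.≈-refl (H.∙-hom a b))
                                     (R.≈-sym (R.∙-assoc x (ν a) (ν b)))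
  ; ◃-identity = λ x → R.≈-trans (R.∙-cong R.≈-refl H.ε-hom) (R.∙-identityʳ x)
  ; ◃-distribˡ = λ f a → R.∙-distribʳ f (ν a)
  ; ◃-distribʳ = λ x g → R.≈-trans (R.∙-cong R.≈-refl (H.⋁-hom g)) (R.∙-distribˡ x (λ i → ν (g i)))
  }
  where
    module R = Quantale R
    module H = IsQuantaleHom hν

-- Tensor product  A ⊗_Q B  of a right Q-module A and a left Q-module B:
-- the quotient of the free sup-lattice ℘(A × B) by the sup-lattice
-- congruence generated by the three families of pairs of the paper.
-- (Elements of ℘(A × B) are subsets of the setoid A × B, i.e. predicates
-- closed under ≈; the quotient is presented as a setoid.)

module Tensor {q qℓ ι a aℓ b bℓ : Level} {Q : Quantale q qℓ ι}
              (A : RightModule Q a aℓ) (B : LeftModule Q b bℓ) where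
  private
    module Q = Quantale Q
    module A = RightModule A
    module B = LeftModule B

  p : Level
  p = q ⊔ a ⊔ aℓ ⊔ b ⊔ bℓ ⊔ ι

  record Sub : Set (suc p) where
    field
      pred : A.Carrier × B.Carrier → Set p
      resp : ∀ {x x′ y y′} → x A.≈ x′ → y B.≈ y′ → pred (x , y) → pred (x′ , y′)
  open Sub public

  ⟦_,_⟧ : A.Carrier → B.Carrier → Sub
  pred ⟦ x , y ⟧ (x′ , y′) = Lift p ((x′ A.≈ x) × (y′ B.≈ y))
  resp ⟦ x , y ⟧ e e′ (lift (u , v)) = lift (A.≈-trans (A.≈-sym e) u , B.≈-trans (B.≈-sym e′) v)

  ⋃ : {I : Set p} → (I → Sub) → Sub
  pred (⋃ {I} F) z = Σ I (λ i → pred (F i) z)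
  resp (⋃ F) e e′ (i , u) = i , resp (F i) e e′ u

  infix 4 _∼_
  data _∼_ : Sub → Sub → Set (suc p) where
    ∼-ext   : ∀ {S T} → (∀ z → (pred S z → pred T z) × (pred T z → pred S z)) → S ∼ T
    ∼-sym   : ∀ {S T} → S ∼ T → T ∼ S
    ∼-trans : ∀ {S T U} → S ∼ T → T ∼ U → S ∼ U
    ∼-⋃     : ∀ {I : Set p} {F G : I → Sub} → (∀ i → F i ∼ G i) → ⋃ F ∼ ⋃ G
    gen-⋁ˡ  : ∀ {I : Set ι} (X : I → A.Carrier) (y : B.Carrier) →
              ⟦ A.⋁ X , y ⟧ ∼ ⋃ {Lift p I} (λ i → ⟦ X (lower i) , y ⟧)
    gen-⋁ʳ  : ∀ (x : A.Carrier) {I : Set ι} (Y : I → B.Carrier) →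
              ⟦ x , B.⋁ Y ⟧ ∼ ⋃ {Lift p I} (λ i → ⟦ x , Y (lower i) ⟧)
    gen-act : ∀ (x : A.Carrier) (c : Q.Carrier) (y : B.Carrier) →
              ⟦ x A.◃ c , y ⟧ ∼ ⟦ x , c B.· y ⟧

  ∼-refl : ∀ {S} → S ∼ S
  ∼-refl = ∼-ext (λ z → id , id)

  ext : ∀ {S T} → (∀ {z} → pred S z → pred T z) → (∀ {z} → pred T z → pred S z) → S ∼ T
  ext f g = ∼-ext (λ z → f , g)

  two : Sub → Sub → Lift p Bool → Sub
  two S T (lift true)  = S
  two S T (lift false) = T

  infixl 6 _∪_
  _∪_ : Sub → Sub → Sub
  S ∪ T = ⋃ (two S T)

  ∪-cong : ∀ {S S′ T T′} → S ∼ S′ → T ∼ T′ → S ∪ T ∼ S′ ∪ T′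
  ∪-cong e e′ = ∼-⋃ λ { (lift true) → e ; (lift false) → e′ }

  infix 4 _⊑_
  _⊑_ : Sub → Sub → Set (suc p)
  S ⊑ T = S ∪ T ∼ T

  ⋁ᵀ : {I : Set ι} → (I → Sub) → Sub
  ⋁ᵀ {I} F = ⋃ {Lift p I} (λ i → F (lower i))

  private
    ∪-idem : ∀ {S} → S ∪ S ∼ S
    ∪-idem = ext (λ { (lift true , u) → u ; (lift false , u) → u }) (λ u → lift true , u)

    ∪-comm : ∀ {S T} → S ∪ T ∼ T ∪ S
    ∪-comm = ext (λ { (lift true , u) → lift false , u ; (lift false , u) → lift true , u })
                 (λ { (lift true , u) → lift false , u ; (lift false , u) → lift true , u })

    ∪-assoc : ∀ {S T U} → (S ∪ T) ∪ U ∼ S ∪ (T ∪ U)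
    ∪-assoc = ext (λ { (lift true , lift true , u) → lift true , u
                     ; (lift true , lift false , u) → lift false , lift true , u
                     ; (lift false , u) → lift false , lift false , u })
                  (λ { (lift true , u) → lift true , lift true , u
                     ; (lift false , lift true , u) → lift true , lift false , u
                     ; (lift false , lift false , u) → lift false , u })

    ⊑-isPartialOrder : IsPartialOrder _∼_ _⊑_
    ⊑-isPartialOrder = record
      { isPreorder = record
        { isEquivalence = record { refl = ∼-refl ; sym = ∼-sym ; trans = ∼-trans }
        ; reflexive = λ e → ∼-trans (∪-cong e ∼-refl) ∪-idem
        ; trans = λ st tu → ∼-trans (∪-cong ∼-refl (∼-sym tu))
                            (∼-trans (∼-sym ∪-assoc) (∼-trans (∪-cong st ∼-refl) tu))
        }
      ; antisym = λ st ts → ∼-trans (∼-sym ts) (∼-trans ∪-comm st)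
      }

    upper : {I : Set ι} (F : I → Sub) (i : I) → F i ⊑ ⋁ᵀ F
    upper F i = ext (λ { (lift true , u) → lift i , u ; (lift false , u) → u })
                    (λ u → lift false , u)

    least : {I : Set ι} (F : I → Sub) (X : Sub) → (∀ i → F i ⊑ X) → ⋁ᵀ F ⊑ X
    least {I} F X h =
      ∼-trans (ext {T = ⋃ G} fw bw) (∼-trans (∼-⋃ {F = G} {G = λ _ → X} step) (ext (λ { (_ , u) → u }) (λ u → lift nothing , u)))
      where
        G : Lift p (Maybe I) → Sub
        G (lift nothing)  = X
        G (lift (just i)) = F i ∪ X
        step : ∀ j → G j ∼ X
        step (lift nothing)  = ∼-refl
        step (lift (just i)) = h i
        fw : ∀ {z} → pred (⋁ᵀ F ∪ X) z → pred (⋃ G) z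
        fw (lift true , lift i , u) = lift (just i) , lift true , u
        fw (lift false , u) = lift nothing , u
        bw : ∀ {z} → pred (⋃ G) z → pred (⋁ᵀ F ∪ X) z
        bw (lift nothing , u) = lift false , u
        bw (lift (just i) , lift true , u) = lift true , lift i , u
        bw (lift (just i) , lift false , u) = lift false , u

  tensor : SupLattice (suc p) (suc p) ι
  tensor = record
    { Carrier = Sub ; _≈_ = _∼_ ; _≤_ = _⊑_ ; isPartialOrder = ⊑-isPartialOrder
    ; ⋁ = ⋁ᵀ ; ⋁-upper = upper ; ⋁-least = least }

  _⊗_ : A.Carrier → B.Carrier → Sub
  x ⊗ y = ⟦ x , y ⟧

module ExtendScalars {q qℓ ι m mℓ : Level} {Q R : Quantale q qℓ ι}
                     {ν : Quantale.Carrier Q → Quantale.Carrier R}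
                     (hν : IsQuantaleHom Q R ν) (M : LeftModule Q m mℓ) where
  private
    module R = Quantale R
    module M = LeftModule M
  open Tensor (restrictRight hν) M public

  act : R.Carrier → Sub → Sub
  act r S = ⋃ {Σ (R.Carrier × M.Carrier) (pred S)} (λ w → ⟦ r R.∙ proj₁ (proj₁ w) , proj₂ (proj₁ w) ⟧)

  private
    sng-cong : ∀ {s s′ y y′} → s R.≈ s′ → y M.≈ y′ → ⟦ s , y ⟧ ∼ ⟦ s′ , y′ ⟧
    sng-cong e e′ = ext (λ { (lift (u , v)) → lift (R.≈-trans u e , M.≈-trans v e′) })
                        (λ { (lift (u , v)) → lift (R.≈-trans u (R.≈-sym e) , M.≈-trans v (M.≈-sym e′)) })

    act-sng : ∀ r s y → act r ⟦ s , y ⟧ ∼ ⟦ r R.∙ s , y ⟧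
    act-sng r s y =
      ext (λ { ((_ , lift (e₁ , e₂)) , lift (u , v)) →
               lift (R.≈-trans u (R.∙-cong R.≈-refl e₁) , M.≈-trans v e₂) })
          (λ u → ((s , y) , lift (R.≈-refl , M.≈-refl)) , u)

    act-⋃ : ∀ r {I : Set p} (F : I → Sub) → act r (⋃ F) ∼ ⋃ (λ i → act r (F i))
    act-⋃ r F = ext (λ { ((w , (i , a)) , u) → i , ((w , a) , u) })
                    (λ { (i , ((w , a) , u)) → (w , (i , a)) , u })

    act-congˡ : ∀ {r r′} S → r R.≈ r′ → act r S ∼ act r′ S
    act-congˡ S e =
      ext (λ { (w , lift (u , v)) → w , lift (R.≈-trans u (R.∙-cong e R.≈-refl) , v) })
          (λ { (w , lift (u , v)) → w , lift (R.≈-trans u (R.∙-cong (R.≈-sym e) R.≈-refl) , v) })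

    act-congʳ : ∀ r {S T} → S ∼ T → act r S ∼ act r T
    act-congʳ r (∼-ext h) = ext (λ { ((w , a) , u) → (w , proj₁ (h _) a) , u })
                               (λ { ((w , a) , u) → (w , proj₂ (h _) a) , u })
    act-congʳ r (∼-sym e) = ∼-sym (act-congʳ r e)
    act-congʳ r (∼-trans e e′) = ∼-trans (act-congʳ r e) (act-congʳ r e′)
    act-congʳ r (∼-⋃ {F = F} {G} h) =
      ∼-trans (act-⋃ r F) (∼-trans (∼-⋃ (λ i → act-congʳ r (h i))) (∼-sym (act-⋃ r G)))
    act-congʳ r (gen-⋁ˡ X y) =
      ∼-trans (act-sng r _ y)
      (∼-trans (sng-cong (R.∙-distribˡ r X) M.≈-refl)
      (∼-trans (gen-⋁ˡ (λ i → r R.∙ X i) y)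
      (∼-trans (∼-⋃ (λ i → ∼-sym (act-sng r (X (lower i)) y)))
               (∼-sym (act-⋃ r (λ i → ⟦ X (lower i) , y ⟧))))))
    act-congʳ r (gen-⋁ʳ x Y) =
      ∼-trans (act-sng r x _)
      (∼-trans (gen-⋁ʳ (r R.∙ x) Y)
      (∼-trans (∼-⋃ (λ i → ∼-sym (act-sng r x (Y (lower i)))))
               (∼-sym (act-⋃ r (λ i → ⟦ x , Y (lower i) ⟧)))))
    act-congʳ r (gen-act x c y) =
      ∼-trans (act-sng r _ y)
      (∼-trans (sng-cong (R.≈-sym (R.∙-assoc r x (ν c))) M.≈-refl)
      (∼-trans (gen-act (r R.∙ x) c y)
               (∼-sym (act-sng r x _))))

    act-assoc : ∀ a b S → act (a R.∙ b) S ∼ act a (act b S)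
    act-assoc a b S =
      ext (λ { (((s , y) , u) , lift (e₁ , e₂)) →
               ((b R.∙ s , y) , (((s , y) , u) , lift (R.≈-refl , M.≈-refl))) ,
               lift (R.≈-trans e₁ (R.∙-assoc a b s) , e₂) })
          (λ { ((_ , (((s , y) , u) , lift (f₁ , f₂))) , lift (e₁ , e₂)) →
               ((s , y) , u) ,
               lift (R.≈-trans e₁ (R.≈-trans (R.∙-cong R.≈-refl f₁) (R.≈-sym (R.∙-assoc a b s))) ,
                     M.≈-trans e₂ f₂) })

    act-identity : ∀ S → act R.ε S ∼ S
    act-identity S =
      ext (λ { (((s , y) , u) , lift (e₁ , e₂)) →
               resp S (R.≈-sym (R.≈-trans e₁ (R.∙-identityˡ s))) (M.≈-sym e₂) u })
          (λ { {t , x} u → ((t , x) , u) , lift (R.≈-sym (R.∙-identityˡ t) , M.≈-refl) })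

    act-distribʳ : ∀ {I : Set ι} (g : I → R.Carrier) S → act (R.⋁ g) S ∼ ⋁ᵀ (λ i → act (g i) S)
    act-distribʳ g S =
      ∼-trans (∼-⋃ (λ w → sng-cong (R.∙-distribʳ g (proj₁ (proj₁ w))) M.≈-refl))
      (∼-trans (∼-⋃ (λ w → gen-⋁ˡ (λ i → g i R.∙ proj₁ (proj₁ w)) (proj₂ (proj₁ w))))
               (ext (λ { (w , (i , u)) → i , (w , u) }) (λ { (i , (w , u)) → w , (i , u) })))

  module′ : LeftModule R (suc p) (suc p)
  module′ = record
    { supLattice = tensor
    ; _·_        = act
    ; ·-cong     = λ {a} {a′} {x} e e′ → ∼-trans (act-congˡ x e) (act-congʳ a′ e′)
    ; ·-assoc    = act-assoc
    ; ·-identity = act-identity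
    ; ·-distribˡ = λ a f → act-⋃ a (λ i → f (lower i))
    ; ·-distribʳ = act-distribʳ
    }

  one⊗ : M.Carrier → Sub
  one⊗ x = R.ε ⊗ x

_⊗ᴹ_ : {q qℓ ι m mℓ : Level} {Q R : Quantale q qℓ ι}
       {ν : Quantale.Carrier Q → Quantale.Carrier R} →
       IsQuantaleHom Q R ν → (M : LeftModule Q m mℓ) →
       LeftModule R (suc (q ⊔ qℓ ⊔ m ⊔ mℓ ⊔ ι)) (suc (q ⊔ qℓ ⊔ m ⊔ mℓ ⊔ ι))
hν ⊗ᴹ M = ExtendScalars.module′ hν M

1⊗ι : {q qℓ ι m mℓ : Level} {Q R : Quantale q qℓ ι}
      {ν : Quantale.Carrier Q → Quantale.Carrier R} →
      (hν : IsQuantaleHom Q R ν) → (M : LeftModule Q m mℓ) →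
      LeftModule.Carrier M → LeftModule.Carrier (hν ⊗ᴹ M)
1⊗ι hν M = ExtendScalars.one⊗ hν M

IsQMMorphism : {q qℓ s sℓ ι m mℓ n nℓ : Level} {Q : Quantale q qℓ ι} {S : Quantale s sℓ ι}
               (M : LeftModule Q m mℓ) (N : LeftModule S n nℓ)
               (h : Quantale.Carrier Q → Quantale.Carrier S)
               (f : LeftModule.Carrier M → LeftModule.Carrier N) →
               Set (q ⊔ qℓ ⊔ sℓ ⊔ m ⊔ mℓ ⊔ nℓ ⊔ suc ι)
IsQMMorphism {Q = Q} {S} M N h f =
  Σ (IsQuantaleHom Q S h) (λ hh → IsModuleHom M (restrict hh N) f)

record IsQuantaleCoproduct {i q qℓ ι : Level} {I : Set i}
                           (Q : I → Quantale q qℓ ι) (R : Quantale q qℓ ι)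
                           (ν : (k : I) → Quantale.Carrier (Q k) → Quantale.Carrier R)
                           (s sℓ : Level) : Set (i ⊔ suc (q ⊔ qℓ ⊔ ι ⊔ s ⊔ sℓ)) where
  field
    ν-hom     : (k : I) → IsQuantaleHom (Q k) R (ν k)
    universal : (S : Quantale s sℓ ι)
                (h : (k : I) → Quantale.Carrier (Q k) → Quantale.Carrier S) →
                ((k : I) → IsQuantaleHom (Q k) S (h k)) →
                Σ (Quantale.Carrier R → Quantale.Carrier S) λ g →
                  IsQuantaleHom R S g ×
                  ((k : I) (a : Quantale.Carrier (Q k)) → Quantale._≈_ S (g (ν k a)) (h k a)) ×
                  ((g′ : Quantale.Carrier R → Quantale.Carrier S) → IsQuantaleHom R S g′ →
                   ((k : I) (a : Quantale.Carrier (Q k)) → Quantale._≈_ S (g′ (ν k a)) (h k a)) →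
                   (r : Quantale.Carrier R) → Quantale._≈_ S (g′ r) (g r))

record IsModuleCoproduct {i q qℓ ι t tℓ c cℓ : Level} {I : Set i} {R : Quantale q qℓ ι}
                         (T : I → LeftModule R t tℓ) (C : LeftModule R c cℓ)
                         (μ : (k : I) → LeftModule.Carrier (T k) → LeftModule.Carrier C)
                         (n nℓ : Level) : Set (i ⊔ q ⊔ qℓ ⊔ suc (ι ⊔ t ⊔ tℓ ⊔ c ⊔ cℓ ⊔ n ⊔ nℓ)) where
  field
    μ-hom     : (k : I) → IsModuleHom (T k) C (μ k)
    universal : (N : LeftModule R n nℓ)
                (f : (k : I) → LeftModule.Carrier (T k) → LeftModule.Carrier N) →
                ((k : I) → IsModuleHom (T k) N (f k)) →
                Σ (LeftModule.Carrier C → LeftModule.Carrier N) λ g →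
                  IsModuleHom C N g ×
                  ((k : I) (x : LeftModule.Carrier (T k)) → LeftModule._≈_ N (g (μ k x)) (f k x)) ×
                  ((g′ : LeftModule.Carrier C → LeftModule.Carrier N) → IsModuleHom C N g′ →
                   ((k : I) (x : LeftModule.Carrier (T k)) → LeftModule._≈_ N (g′ (μ k x)) (f k x)) →
                   (z : LeftModule.Carrier C) → LeftModule._≈_ N (g′ z) (g z))

record IsQMCoproduct {i q qℓ r rℓ ι m mℓ c cℓ : Level} {I : Set i}
                     (Q : I → Quantale q qℓ ι) (M : (k : I) → LeftModule (Q k) m mℓ)
                     (R : Quantale r rℓ ι) (C : LeftModule R c cℓ)
                     (ν : (k : I) → Quantale.Carrier (Q k) → Quantale.Carrier R)
                     (κ : (k : I) → LeftModule.Carrier (M k) → LeftModule.Carrier C)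
                     (s sℓ n nℓ : Level)
                     : Set (i ⊔ suc (q ⊔ qℓ ⊔ r ⊔ rℓ ⊔ ι ⊔ m ⊔ mℓ ⊔ c ⊔ cℓ ⊔ s ⊔ sℓ ⊔ n ⊔ nℓ)) where
  field
    coproj    : (k : I) → IsQMMorphism (M k) C (ν k) (κ k)
    universal : (S : Quantale s sℓ ι) (N : LeftModule S n nℓ)
                (h : (k : I) → Quantale.Carrier (Q k) → Quantale.Carrier S)
                (f : (k : I) → LeftModule.Carrier (M k) → LeftModule.Carrier N) →
                ((k : I) → IsQMMorphism (M k) N (h k) (f k)) →
                Σ (Quantale.Carrier R → Quantale.Carrier S) λ g →
                Σ (LeftModule.Carrier C → LeftModule.Carrier N) λ φ →
                  IsQMMorphism C N g φ ×
                  ((k : I) (a : Quantale.Carrier (Q k)) → Quantale._≈_ S (g (ν k a)) (h k a)) ×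
                  ((k : I) (x : LeftModule.Carrier (M k)) → LeftModule._≈_ N (φ (κ k x)) (f k x)) ×
                  ((g′ : Quantale.Carrier R → Quantale.Carrier S)
                   (φ′ : LeftModule.Carrier C → LeftModule.Carrier N) → IsQMMorphism C N g′ φ′ →
                   ((k : I) (a : Quantale.Carrier (Q k)) → Quantale._≈_ S (g′ (ν k a)) (h k a)) →
                   ((k : I) (x : LeftModule.Carrier (M k)) → LeftModule._≈_ N (φ′ (κ k x)) (f k x)) →
                   ((r : Quantale.Carrier R) → Quantale._≈_ S (g′ r) (g r)) ×
                   ((z : LeftModule.Carrier C) → LeftModule._≈_ N (φ′ z) (φ z)))

-- The quantale part of the universal property is that of R.  For the module
-- part, a QM-morphism (h_k, f_k) out of (Q_k, M_k) into (S, N) gives, once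
-- h_k is factored as g ∘ ν_k through the mediating quantale map g : R → S, a
-- Q_k-module map M_k → (N_g)_{ν_k}.  Extension of scalars is left adjoint to
-- restriction, so it extends uniquely to an R-module map R ⊗_{Q_k} M_k → N_g,
-- s ⊗ x ↦ g(s) · f_k(x), and the coproduct of R-modules glues these together.
module Submission where

open import Level using (Level; Lift; lift; lower)
open import Function using (_∘_)
open import Data.Product using (Σ; _×_; _,_; proj₁; proj₂)
open import Relation.Binary using (IsPartialOrder; Setoid)
import Relation.Binary.Reasoning.Setoid as ≈-Reasoning
open import Defs

module SupLatticeProperties {c ℓ ι : Level} (L : SupLattice c ℓ ι) where
  open SupLattice L
  open IsPartialOrder isPartialOrder using (reflexive; antisym) renaming (trans to ≤-trans)

  setoid : Setoid c ℓ
  setoid = record { isEquivalence = isEquivalence }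

  ⋁-reindex-≤ : {I J : Set ι} (f : I → Carrier) (g : J → Carrier) →
                (∀ i → Σ J λ j → f i ≈ g j) → ⋁ f ≤ ⋁ g
  ⋁-reindex-≤ f g σ =
    ⋁-least f (⋁ g) (λ i → ≤-trans (reflexive (proj₂ (σ i))) (⋁-upper g (proj₁ (σ i))))

  ⋁-reindex : {I J : Set ι} (f : I → Carrier) (g : J → Carrier) →
              (∀ i → Σ J λ j → f i ≈ g j) → (∀ j → Σ I λ i → g j ≈ f i) → ⋁ f ≈ ⋁ g
  ⋁-reindex f g σ τ = antisym (⋁-reindex-≤ f g σ) (⋁-reindex-≤ g f τ)

  ⋁-cong : {I : Set ι} {f g : I → Carrier} → (∀ i → f i ≈ g i) → ⋁ f ≈ ⋁ g
  ⋁-cong {f = f} {g} e = ⋁-reindex f g (λ i → i , e i) (λ i → i , ≈-sym (e i))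

  ⋁-lift : {I : Set ι} (f : I → Carrier) → ⋁ {Lift ι I} (f ∘ lower) ≈ ⋁ f
  ⋁-lift f = ⋁-reindex (f ∘ lower) f (λ i → lower i , ≈-refl) (λ i → lift i , ≈-refl)

module _ {q qℓ ι a aℓ b bℓ c cℓ : Level} {Q : Quantale q qℓ ι}
         {A : LeftModule Q a aℓ} {B : LeftModule Q b bℓ} {C : LeftModule Q c cℓ}
         {f : LeftModule.Carrier A → LeftModule.Carrier B}
         {g : LeftModule.Carrier B → LeftModule.Carrier C} where
  private
    module C = LeftModule C
    module F = IsModuleHom
  open ≈-Reasoning (SupLatticeProperties.setoid C.supLattice)

  ∘-isModuleHom : IsModuleHom B C g → IsModuleHom A B f → IsModuleHom A C (g ∘ f)
  ∘-isModuleHom g-hom f-hom = record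
    { isSupHom = record
      { cong  = F.cong g-hom ∘ F.cong f-hom
      ; ⋁-hom = λ h → C.≈-trans (F.cong g-hom (F.⋁-hom f-hom h)) (F.⋁-hom g-hom (f ∘ h)) }
    ; ·-hom = λ r x → begin
        g (f (r A· x))   ≈⟨ F.cong g-hom (F.·-hom f-hom r x) ⟩
        g (r B· f x)     ≈⟨ F.·-hom g-hom r (f x) ⟩
        r C.· g (f x)    ∎ }
    where
      open LeftModule A using () renaming (_·_ to _A·_)
      open LeftModule B using () renaming (_·_ to _B·_)

module _ {q qℓ s sℓ ι a aℓ b bℓ : Level} {Q : Quantale q qℓ ι} {S : Quantale s sℓ ι}
         {h : Quantale.Carrier Q → Quantale.Carrier S} (h-hom : IsQuantaleHom Q S h)
         {A : LeftModule S a aℓ} {B : LeftModule S b bℓ}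
         {f : LeftModule.Carrier A → LeftModule.Carrier B} where

  restrict-isModuleHom : IsModuleHom A B f → IsModuleHom (restrict h-hom A) (restrict h-hom B) f
  restrict-isModuleHom f-hom = record { isSupHom = isSupHom ; ·-hom = λ a x → ·-hom (h a) x }
    where open IsModuleHom f-hom

module _ {q qℓ s sℓ ι m mℓ n nℓ : Level}
         {Q : Quantale q qℓ ι} {S : Quantale s sℓ ι}
         {M : LeftModule Q m mℓ} {N : LeftModule S n nℓ}
         {f : LeftModule.Carrier M → LeftModule.Carrier N} where
  private
    module S = Quantale S
    module N = LeftModule N

  restrict-cong-isModuleHom : {h h′ : Quantale.Carrier Q → S.Carrier}
    (h-hom : IsQuantaleHom Q S h) (h′-hom : IsQuantaleHom Q S h′) → (∀ a → h a S.≈ h′ a) →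
    IsModuleHom M (restrict h-hom N) f → IsModuleHom M (restrict h′-hom N) f
  restrict-cong-isModuleHom _ _ h≈h′ f-hom = record
    { isSupHom = isSupHom
    ; ·-hom    = λ a x → N.≈-trans (·-hom a x) (N.·-cong (h≈h′ a) N.≈-refl) }
    where open IsModuleHom f-hom

  restrict-∘-isModuleHom : ∀ {r rℓ} {R : Quantale r rℓ ι} {g : Quantale.Carrier R → S.Carrier}
    {ν : Quantale.Carrier Q → Quantale.Carrier R} {h : Quantale.Carrier Q → S.Carrier}
    (g-hom : IsQuantaleHom R S g) (ν-hom : IsQuantaleHom Q R ν) (h-hom : IsQuantaleHom Q S h) →
    (∀ a → g (ν a) S.≈ h a) →
    IsModuleHom M (restrict h-hom N) f → IsModuleHom M (restrict ν-hom (restrict g-hom N)) f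
  restrict-∘-isModuleHom _ _ _ gν≈h f-hom = record
    { isSupHom = isSupHom
    ; ·-hom    = λ a x → N.≈-trans (·-hom a x) (N.·-cong (S.≈-sym (gν≈h a)) N.≈-refl) }
    where open IsModuleHom f-hom

-- All levels are ι because extension of scalars takes the join of
-- s · f x over the generators of an element, a family indexed by R × M.
module ExtensionOfScalars {ι : Level} {Q R : Quantale ι ι ι}
                          {ν : Quantale.Carrier Q → Quantale.Carrier R}
                          (ν-hom : IsQuantaleHom Q R ν) (M : LeftModule Q ι ι) where
  private
    module R = Quantale R
    module M = LeftModule M
  open ExtendScalars ν-hom M

  ⊗-cong : ∀ {s s′ x x′} → s R.≈ s′ → x M.≈ x′ → s ⊗ x ∼ s′ ⊗ x′
  ⊗-cong e e′ = ext (λ { (lift (u , v)) → lift (R.≈-trans u e , M.≈-trans v e′) })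
                    (λ { (lift (u , v)) → lift (R.≈-trans u (R.≈-sym e) , M.≈-trans v (M.≈-sym e′)) })

  act-⊗ : ∀ r s x → act r (s ⊗ x) ∼ (r R.∙ s) ⊗ x
  act-⊗ r s x =
    ext (λ { ((_ , lift (e₁ , e₂)) , lift (u , v)) →
             lift (R.≈-trans u (R.∙-cong R.≈-refl e₁) , M.≈-trans v e₂) })
        (λ u → ((s , x) , lift (R.≈-refl , M.≈-refl)) , u)

  Generator : Sub → Set ι
  Generator T = Σ (R.Carrier × M.Carrier) (pred T)

  generator-⊗ : ∀ {T} → Generator T → Sub
  generator-⊗ ((s , x) , _) = s ⊗ x

  ⋁-generators : ∀ T → T ∼ ⋁ᵀ (generator-⊗ {T})
  ⋁-generators T =
    ext (λ { {s , x} u → lift ((s , x) , u) , lift (R.≈-refl , M.≈-refl) })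
        (λ { (lift (_ , u) , lift (e₁ , e₂)) → resp T (R.≈-sym e₁) (M.≈-sym e₂) u })

  ε⊗-·-hom : ∀ a x → R.ε ⊗ (a M.· x) ∼ act (ν a) (R.ε ⊗ x)
  ε⊗-·-hom a x = ∼-trans (∼-sym (gen-act R.ε a x))
                 (∼-trans (⊗-cong ε∙νa≈νa∙ε M.≈-refl) (∼-sym (act-⊗ (ν a) R.ε x)))
    where
      ε∙νa≈νa∙ε : R.ε R.∙ ν a R.≈ ν a R.∙ R.ε
      ε∙νa≈νa∙ε = R.≈-trans (R.∙-identityˡ (ν a)) (R.≈-sym (R.∙-identityʳ (ν a)))

  1⊗ι-isModuleHom : IsModuleHom M (restrict ν-hom (ν-hom ⊗ᴹ M)) (1⊗ι ν-hom M)
  1⊗ι-isModuleHom = record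
    { isSupHom = record { cong = ⊗-cong R.≈-refl ; ⋁-hom = gen-⋁ʳ R.ε }
    ; ·-hom    = ε⊗-·-hom }

  module Extension {n nℓ : Level} (N : LeftModule R n nℓ)
                   {f : M.Carrier → LeftModule.Carrier N}
                   (f-hom : IsModuleHom M (restrict ν-hom N) f) where
    private
      module N = LeftModule N
      module f = IsModuleHom f-hom
      open SupLatticeProperties N.supLattice
      open IsPartialOrder N.isPartialOrder using (reflexive; antisym) renaming (trans to ≤-trans)

    value : R.Carrier × M.Carrier → N.Carrier
    value (s , x) = s N.· f x

    extend : Sub → N.Carrier
    extend T = N.⋁ {Generator T} (value ∘ proj₁)

    extend-⊗ : ∀ s x → extend (s ⊗ x) N.≈ s N.· f x
    extend-⊗ s x = antisym
      (N.⋁-least _ _ (λ { (_ , lift (e₁ , e₂)) → reflexive (N.·-cong e₁ (f.cong e₂)) }))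
      (N.⋁-upper _ ((s , x) , lift (R.≈-refl , M.≈-refl)))

    extend-⋃ : {J : Set ι} (F : J → Sub) → extend (⋃ F) N.≈ N.⋁ (extend ∘ F)
    extend-⋃ F = antisym
      (N.⋁-least _ _ (λ { (z , (j , u)) → ≤-trans (N.⋁-upper _ (z , u)) (N.⋁-upper _ j) }))
      (N.⋁-least _ _ (λ j → N.⋁-least _ _ (λ { (z , u) → N.⋁-upper _ (z , (j , u)) })))

    extend-⋁ : {J : Set ι} (F : J → Sub) → extend (⋁ᵀ F) N.≈ N.⋁ (extend ∘ F)
    extend-⋁ F = N.≈-trans (extend-⋃ (F ∘ lower)) (⋁-lift (extend ∘ F))

    extend-⋁-⊗ : {J : Set ι} (X : J → R.Carrier) (Y : J → M.Carrier) →
                 extend (⋁ᵀ (λ j → X j ⊗ Y j)) N.≈ N.⋁ (λ j → X j N.· f (Y j))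
    extend-⋁-⊗ X Y = N.≈-trans (extend-⋁ (λ j → X j ⊗ Y j)) (⋁-cong (λ j → extend-⊗ (X j) (Y j)))

    -- Well defined on the quotient: the generating pairs are respected because
    -- f preserves joins and the action.
    extend-cong : ∀ {T T′} → T ∼ T′ → extend T N.≈ extend T′
    extend-cong (∼-ext T≡T′) = ⋁-reindex _ _ (λ { (z , u) → (z , proj₁ (T≡T′ z) u) , N.≈-refl })
                                             (λ { (z , u) → (z , proj₂ (T≡T′ z) u) , N.≈-refl })
    extend-cong (∼-sym e) = N.≈-sym (extend-cong e)
    extend-cong (∼-trans e e′) = N.≈-trans (extend-cong e) (extend-cong e′)
    extend-cong (∼-⋃ {F = F} {G} e) = begin
      extend (⋃ F)            ≈⟨ extend-⋃ F ⟩
      N.⋁ (extend ∘ F)        ≈⟨ ⋁-cong (extend-cong ∘ e) ⟩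
      N.⋁ (extend ∘ G)        ≈⟨ extend-⋃ G ⟨
      extend (⋃ G)            ∎
      where open ≈-Reasoning setoid
    extend-cong (gen-⋁ˡ X x) = begin
      extend (R.⋁ X ⊗ x)      ≈⟨ extend-⊗ (R.⋁ X) x ⟩
      R.⋁ X N.· f x           ≈⟨ N.·-distribʳ X (f x) ⟩
      N.⋁ (λ j → X j N.· f x) ≈⟨ extend-⋁-⊗ X (λ _ → x) ⟨
      extend (⋁ᵀ (λ j → X j ⊗ x)) ∎
      where open ≈-Reasoning setoid
    extend-cong (gen-⋁ʳ s Y) = begin
      extend (s ⊗ M.⋁ Y)          ≈⟨ extend-⊗ s (M.⋁ Y) ⟩
      s N.· f (M.⋁ Y)             ≈⟨ N.·-cong R.≈-refl (f.⋁-hom Y) ⟩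
      s N.· N.⋁ (f ∘ Y)           ≈⟨ N.·-distribˡ s (f ∘ Y) ⟩
      N.⋁ (λ j → s N.· f (Y j))   ≈⟨ extend-⋁-⊗ (λ _ → s) Y ⟨
      extend (⋁ᵀ (λ j → s ⊗ Y j)) ∎
      where open ≈-Reasoning setoid
    extend-cong (gen-act s a x) = begin
      extend ((s R.∙ ν a) ⊗ x)    ≈⟨ extend-⊗ (s R.∙ ν a) x ⟩
      (s R.∙ ν a) N.· f x         ≈⟨ N.·-assoc s (ν a) (f x) ⟩
      s N.· ν a N.· f x           ≈⟨ N.·-cong R.≈-refl (f.·-hom a x) ⟨
      s N.· f (a M.· x)           ≈⟨ extend-⊗ s (a M.· x) ⟨
      extend (s ⊗ (a M.· x))      ∎
      where open ≈-Reasoning setoid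

    extend-·-hom : ∀ r T → extend (act r T) N.≈ r N.· extend T
    extend-·-hom r T = begin
      extend (act r T)                   ≈⟨ extend-⋃ scaled ⟩
      N.⋁ (extend ∘ scaled)              ≈⟨ ⋁-cong (λ w → extend-⊗ (r R.∙ s w) (x w)) ⟩
      N.⋁ (λ w → (r R.∙ s w) N.· f (x w)) ≈⟨ ⋁-cong (λ w → N.·-assoc r (s w) (f (x w))) ⟩
      N.⋁ (λ w → r N.· value (proj₁ w))  ≈⟨ N.·-distribˡ r (value ∘ proj₁) ⟨
      r N.· extend T                     ∎
      where
        open ≈-Reasoning setoid
        s : Generator T → R.Carrier
        s = proj₁ ∘ proj₁
        x : Generator T → M.Carrier
        x = proj₂ ∘ proj₁
        scaled : Generator T → Sub
        scaled w = (r R.∙ s w) ⊗ x w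

    extend-isModuleHom : IsModuleHom (ν-hom ⊗ᴹ M) N extend
    extend-isModuleHom = record
      { isSupHom = record { cong = extend-cong ; ⋁-hom = extend-⋁ }
      ; ·-hom    = extend-·-hom }

    extend-1⊗ι : ∀ x → extend (1⊗ι ν-hom M x) N.≈ f x
    extend-1⊗ι x = N.≈-trans (extend-⊗ R.ε x) (N.·-identity (f x))

    -- s ⊗ x = s · (1 ⊗ x), and the s ⊗ x generate the tensor product.
    extend-unique : {φ : Sub → N.Carrier} → IsModuleHom (ν-hom ⊗ᴹ M) N φ →
                    (∀ x → φ (1⊗ι ν-hom M x) N.≈ f x) → ∀ T → φ T N.≈ extend T
    extend-unique {φ} φ-hom φ-1⊗ι T = begin
      φ T                                    ≈⟨ φ.cong (⋁-generators T) ⟩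
      φ (⋁ᵀ (generator-⊗ {T}))               ≈⟨ φ.⋁-hom _ ⟩
      N.⋁ (λ { ((s , x) , _) → φ (s ⊗ x) })  ≈⟨ ⋁-cong (λ { ((s , x) , _) → φ-⊗ s x }) ⟩
      extend T                               ∎
      where
        module φ = IsModuleHom φ-hom
        open ≈-Reasoning setoid
        φ-⊗ : ∀ s x → φ (s ⊗ x) N.≈ s N.· f x
        φ-⊗ s x = begin
          φ (s ⊗ x)                  ≈⟨ φ.cong (⊗-cong (R.∙-identityʳ s) M.≈-refl) ⟨
          φ ((s R.∙ R.ε) ⊗ x)        ≈⟨ φ.cong (act-⊗ s R.ε x) ⟨
          φ (act s (R.ε ⊗ x))        ≈⟨ φ.·-hom s (R.ε ⊗ x) ⟩
          s N.· φ (R.ε ⊗ x)          ≈⟨ N.·-cong R.≈-refl (φ-1⊗ι x) ⟩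
          s N.· f x                  ∎

module QMCoproduct {i ι c cℓ s sℓ n nℓ : Level} {I : Set i}
    (Q : I → Quantale ι ι ι) (M : (k : I) → LeftModule (Q k) ι ι)
    (R : Quantale ι ι ι) (ν : (k : I) → Quantale.Carrier (Q k) → Quantale.Carrier R)
    (R-coprod : IsQuantaleCoproduct Q R ν s sℓ)
    (C : LeftModule R c cℓ)
    (μ : (k : I) → LeftModule.Carrier (IsQuantaleCoproduct.ν-hom R-coprod k ⊗ᴹ M k) → LeftModule.Carrier C)
    (C-coprod : IsModuleCoproduct (λ k → IsQuantaleCoproduct.ν-hom R-coprod k ⊗ᴹ M k) C μ n nℓ) where
  private
    module R = Quantale R
    module C = LeftModule C
  open IsQuantaleCoproduct R-coprod using (ν-hom) renaming (universal to R-universal)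
  open IsModuleCoproduct C-coprod using (μ-hom) renaming (universal to C-universal)

  κ : (k : I) → LeftModule.Carrier (M k) → C.Carrier
  κ k = μ k ∘ 1⊗ι (ν-hom k) (M k)

  κ-isQMMorphism : (k : I) → IsQMMorphism (M k) C (ν k) (κ k)
  κ-isQMMorphism k = ν-hom k , ∘-isModuleHom (restrict-isModuleHom (ν-hom k) (μ-hom k))
                                             (ExtensionOfScalars.1⊗ι-isModuleHom (ν-hom k) (M k))

  module Mediating (S : Quantale s sℓ ι) (N : LeftModule S n nℓ)
                   (h : (k : I) → Quantale.Carrier (Q k) → Quantale.Carrier S)
                   (f : (k : I) → LeftModule.Carrier (M k) → LeftModule.Carrier N)
                   (hf : (k : I) → IsQMMorphism (M k) N (h k) (f k)) where
    private
      module S = Quantale S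
      module N = LeftModule N
      R-mediating = R-universal S h (proj₁ ∘ hf)

    g : R.Carrier → S.Carrier
    g = proj₁ R-mediating

    g-hom : IsQuantaleHom R S g
    g-hom = proj₁ (proj₂ R-mediating)

    g∘ν≈h : (k : I) (a : Quantale.Carrier (Q k)) → g (ν k a) S.≈ h k a
    g∘ν≈h = proj₁ (proj₂ (proj₂ R-mediating))

    N-g : LeftModule R n nℓ
    N-g = restrict g-hom N

    module Extensionₖ (k : I) = ExtensionOfScalars.Extension (ν-hom k) (M k) N-g
      (restrict-∘-isModuleHom {N = N} g-hom (ν-hom k) (proj₁ (hf k)) (g∘ν≈h k) (proj₂ (hf k)))

    private
      C-mediating = C-universal N-g Extensionₖ.extend Extensionₖ.extend-isModuleHom

    φ : C.Carrier → N.Carrier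
    φ = proj₁ C-mediating

    φ-hom : IsModuleHom C N-g φ
    φ-hom = proj₁ (proj₂ C-mediating)

    φ∘κ≈f : (k : I) (x : LeftModule.Carrier (M k)) → φ (κ k x) N.≈ f k x
    φ∘κ≈f k x = N.≈-trans (proj₁ (proj₂ (proj₂ C-mediating)) k _) (Extensionₖ.extend-1⊗ι k x)

    unique : (g′ : R.Carrier → S.Carrier) (φ′ : C.Carrier → N.Carrier) → IsQMMorphism C N g′ φ′ →
             ((k : I) (a : Quantale.Carrier (Q k)) → g′ (ν k a) S.≈ h k a) →
             ((k : I) (x : LeftModule.Carrier (M k)) → φ′ (κ k x) N.≈ f k x) →
             ((r : R.Carrier) → g′ r S.≈ g r) × ((z : C.Carrier) → φ′ z N.≈ φ z)
    unique g′ φ′ (g′-hom , φ′-hom) g′∘ν≈h φ′∘κ≈f = g′≈g , φ′≈φ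
      where
        g′≈g = proj₂ (proj₂ (proj₂ R-mediating)) g′ g′-hom g′∘ν≈h
        φ′-hom-g : IsModuleHom C N-g φ′
        φ′-hom-g = restrict-cong-isModuleHom {N = N} g′-hom g-hom g′≈g φ′-hom
        φ′≈φ = proj₂ (proj₂ (proj₂ C-mediating)) φ′ φ′-hom-g
          (λ k → Extensionₖ.extend-unique k (∘-isModuleHom φ′-hom-g (μ-hom k)) (φ′∘κ≈f k))

theorem3p1 : ∀ {i ι c cℓ s sℓ n nℓ : Level} {I : Set i}
    (Q : I → Quantale ι ι ι) (M : (k : I) → LeftModule (Q k) ι ι)
    (R : Quantale ι ι ι) (ν : (k : I) → Quantale.Carrier (Q k) → Quantale.Carrier R)
    (R-coprod : IsQuantaleCoproduct Q R ν s sℓ)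
    (C : LeftModule R c cℓ)
    (μ : (k : I) → LeftModule.Carrier (IsQuantaleCoproduct.ν-hom R-coprod k ⊗ᴹ M k) → LeftModule.Carrier C)
    (C-coprod : IsModuleCoproduct (λ k → IsQuantaleCoproduct.ν-hom R-coprod k ⊗ᴹ M k) C μ n nℓ) →
    IsQMCoproduct Q M R C ν (λ k x → μ k (1⊗ι (IsQuantaleCoproduct.ν-hom R-coprod k) (M k) x)) s sℓ n nℓ
theorem3p1 Q M R ν R-coprod C μ C-coprod = record
  { coproj    = κ-isQMMorphism
  ; universal = λ S N h f hf → let open Mediating S N h f hf in
      g , φ , (g-hom , φ-hom) , g∘ν≈h , φ∘κ≈f , unique }
  where open QMCoproduct Q M R ν R-coprod C μ C-coprod
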